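{- For every $n\ge1$, $$\sum_{e\in\mathbf{I}_n(021)}t^{\mathrm{asc}(e)}=\sum_{k=0}^{\lfloor (n-1)/2\rfloor}\bigl|\widetilde{\mathbf{I}_{n,k}}(021)\bigr|\,t^k(1+t)^{n-1-2k}.$$
   Context: $\mathbf{I}_n$ is the set of integer sequences $e=(e_1,\dots,e_n)$ with $0\le e_i\le i-1$; $\mathbf{I}_n(021)$ is the subset avoiding the pattern $021$ (no $i<j<k$ with $e_i<e_k<e_j$). $\mathrm{ASC}(e)=\{i\in[n-1]:e_i<e_{i+1}\}$ and $\mathrm{asc}(e)=|\mathrm{ASC}(e)|$. An index $i\in[n-2]$ is a double ascent of $e$ if $\{i,i+1\}\subseteq\mathrm{ASC}(e)$. $\widetilde{\mathbf{I}_{n,k}}(021)=\{e\in\mathbf{I}_n(021):\mathrm{asc}(e)=k,\ e \text{ has no double ascents, and } e_{n-1}\ge e_n\}$. -}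

module Defs where

open import Data.Nat using (ℕ; zero; suc; _+_; _*_; _∸_; _^_; _<ᵇ_; _≤ᵇ_; _/_)
open import Data.Bool using (Bool; true; false; _∧_; _∨_; not)
open import Data.List using (List; []; _∷_; _++_; [_]; map; concatMap; upTo; filterᵇ; length)
open import Data.Nat.ListAction using (sum)
open import Data.Bool.ListAction using (any)

I : ℕ → List (List ℕ)
I zero    = [] ∷ []
I (suc n) = concatMap (λ e → map (λ x → e ++ [ x ]) (upTo (suc n))) (I n)

asc : List ℕ → ℕ
asc []           = 0
asc (x ∷ [])     = 0
asc (x ∷ y ∷ ys) = (if x <ᵇ y then 1 else 0) + asc (y ∷ ys)
  where
  if_then_else_ : Bool → ℕ → ℕ → ℕ
  if true  then a else b = a
  if false then a else b = b

pat21 : ℕ → List ℕ → Bool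
pat21 x []       = false
pat21 x (y ∷ ys) = any (λ z → (x <ᵇ z) ∧ (z <ᵇ y)) ys ∨ pat21 x ys

contains021 : List ℕ → Bool
contains021 []       = false
contains021 (x ∷ xs) = pat21 x xs ∨ contains021 xs

avoids021 : List ℕ → Bool
avoids021 e = not (contains021 e)

hasDoubleAscent : List ℕ → Bool
hasDoubleAscent (x ∷ y ∷ z ∷ zs) = ((x <ᵇ y) ∧ (y <ᵇ z)) ∨ hasDoubleAscent (y ∷ z ∷ zs)
hasDoubleAscent _                = false

-- lastWeak e = true iff e_{n-1} ≥ e_n (vacuously true when n ≤ 1)
lastWeak : List ℕ → Bool
lastWeak (x ∷ y ∷ [])     = y ≤ᵇ x
lastWeak (x ∷ y ∷ z ∷ zs) = lastWeak (y ∷ z ∷ zs)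
lastWeak _                = true

I021 : ℕ → List (List ℕ)
I021 n = filterᵇ avoids021 (I n)

Itilde : ℕ → ℕ → List (List ℕ)
Itilde n k = filterᵇ (λ e → (asc e ≡ᵇ k) ∧ (not (hasDoubleAscent e) ∧ lastWeak e)) (I021 n)
  where open import Data.Nat using (_≡ᵇ_)

lhs : ℕ → ℕ → ℕ
lhs n t = sum (map (λ e → t ^ asc e) (I021 n))

rhs : ℕ → ℕ → ℕ
rhs n t = sum (map (λ k → length (Itilde n k) * (t ^ k) * ((1 + t) ^ (n ∸ 1 ∸ 2 * k)))
                   (upTo (suc ((n ∸ 1) / 2))))

module Submission where

-- An inversion sequence starting with 0 avoids 021 iff every new entry is 0 or at least the
-- current maximum, so the state (length, maximum, last entry, last step an ascent) drives a
-- transfer recursion.  Both sides are weighted sums over I_n(021) of a product along the ascent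
-- word: on the left t per ascent; on the right t per ascent, 1 for the descent right after it,
-- 1 + t for every other descent, and 0 for a double or a final ascent, which is exactly
-- t^k (1+t)^(n-1-2k) on Ĩ_{n,k}(021) and 0 elsewhere.  Cutting at the last use of the largest
-- admissible value expresses everything through two kinds of states, valleys (last entry 0) and
-- peaks (last entry the maximum), by convolutions.  The valley and peak values of the two
-- weightings then obey the same recursions, because in the second one a peak reached by a
-- descent is worth exactly 1 + t times a peak reached by an ascent.

open import Defs
open import Data.Nat using (ℕ; _≤_)
open import Relation.Binary.PropositionalEquality using (_≡_)

open import Data.Nat using (zero; suc; _+_; _*_; _∸_; _^_; _<ᵇ_; _≤ᵇ_; _≡ᵇ_; _⊔_; _<_; s≤s; z≤n; _/_)
open import Data.Nat.Properties
open import Algebra.Properties.CommutativeSemigroup +-commutativeSemigroup using () renaming (interchange to +-interchange)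
open import Data.Nat.Induction using (<-rec)
open import Data.Nat.DivMod using (m*n/n≡m; /-monoˡ-≤)
open import Data.Bool using (Bool; true; false; _∧_; _∨_; not; T)
open import Data.List using (List; []; _∷_; _++_; [_]; map; foldr; concatMap; upTo; applyUpTo; filterᵇ; length)
open import Data.List.Properties using (map-++; map-∘; map-cong; map-cong-local; length-++)
open import Data.List.Relation.Unary.All as All using (All; []; _∷_)
open import Data.List.Relation.Unary.All.Properties using (concat⁺; map⁺)
open import Data.Nat.ListAction using (sum)
open import Data.Nat.ListAction.Properties using (sum-++)
open import Relation.Binary.PropositionalEquality using (refl; sym; trans; cong; cong₂; subst; subst₂; module ≡-Reasoning)
open import Data.Nat.Tactic.RingSolver using (solve-∀)
open import Data.Bool.Properties using (∨-identityʳ; ∨-assoc; ∧-zeroʳ; T-∨; T-∧; T-≡; T-not-≡)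
open import Data.Bool.Solver using (module ∨-∧-Solver)
open ∨-∧-Solver using (solve; _:=_; _:+_; _:*_)
open import Data.Bool.ListAction using (any)
open import Data.Product using (Σ; _×_; _,_; proj₁; proj₂)
open import Data.Sum using (inj₁; inj₂)
open import Data.Empty using (⊥-elim)
open import Function using (case_of_)
open import Function.Bundles using (Equivalence)

𝟙 : Bool → ℕ
𝟙 true  = 1
𝟙 false = 0

𝟙-∧ : ∀ a b → 𝟙 (a ∧ b) ≡ 𝟙 a * 𝟙 b
𝟙-∧ true  b = sym (*-identityˡ (𝟙 b))
𝟙-∧ false b = refl

𝟙*-cong : ∀ b {x y : ℕ} → (T b → x ≡ y) → 𝟙 b * x ≡ 𝟙 b * y
𝟙*-cong true  x≡y = cong (1 *_) (x≡y _)
𝟙*-cong false x≡y = refl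

∑< : ℕ → (ℕ → ℕ) → ℕ
∑< zero    f = 0
∑< (suc n) f = f 0 + ∑< n (λ x → f (suc x))

syntax ∑< n (λ x → e) = ∑[ x < n ] e

∑-cong : ∀ n {f g : ℕ → ℕ} → (∀ x → x < n → f x ≡ g x) → ∑< n f ≡ ∑< n g
∑-cong zero    f≡g = refl
∑-cong (suc n) f≡g = cong₂ _+_ (f≡g 0 (s≤s z≤n)) (∑-cong n (λ x x<n → f≡g (suc x) (s≤s x<n)))

∑-zero : ∀ n (f : ℕ → ℕ) → (∀ x → x < n → f x ≡ 0) → ∑< n f ≡ 0
∑-zero zero    f f≡0 = refl
∑-zero (suc n) f f≡0 = cong₂ _+_ (f≡0 0 (s≤s z≤n)) (∑-zero n _ (λ x x<n → f≡0 (suc x) (s≤s x<n)))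

∑-+ : ∀ n (f g : ℕ → ℕ) → ∑[ x < n ] (f x + g x) ≡ ∑< n f + ∑< n g
∑-+ zero    f g = refl
∑-+ (suc n) f g rewrite ∑-+ n (λ x → f (suc x)) (λ x → g (suc x)) = +-interchange (f 0) (g 0) _ _

∑-*ˡ : ∀ n c (f : ℕ → ℕ) → ∑[ x < n ] (c * f x) ≡ c * ∑< n f
∑-*ˡ zero    c f = sym (*-zeroʳ c)
∑-*ˡ (suc n) c f rewrite ∑-*ˡ n c (λ x → f (suc x)) = sym (*-distribˡ-+ c (f 0) _)

∑-*ʳ : ∀ n c (f : ℕ → ℕ) → ∑[ x < n ] (f x * c) ≡ ∑< n f * c
∑-*ʳ zero    c f = refl
∑-*ʳ (suc n) c f rewrite ∑-*ʳ n c (λ x → f (suc x)) = sym (*-distribʳ-+ c (f 0) _)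

∑-last : ∀ n (f : ℕ → ℕ) → ∑< (suc n) f ≡ ∑< n f + f n
∑-last zero    f = +-identityʳ (f 0)
∑-last (suc n) f rewrite ∑-last n (λ x → f (suc x)) = sym (+-assoc (f 0) _ _)

∑-pick : ∀ K a (f : ℕ → ℕ) → a ≤ K → ∑[ k < suc K ] (𝟙 (a ≡ᵇ k) * f k) ≡ f a
∑-pick K       zero    f _ = trans (cong₂ _+_ (+-identityʳ (f 0)) (∑-zero K _ (λ _ _ → refl))) (+-identityʳ (f 0))
∑-pick (suc K) (suc a) f (s≤s a≤K) = ∑-pick K a (λ k → f (suc k)) a≤K

-- conv f g r = ∑_{k + s + 1 = r} f k * g k s
conv : (ℕ → ℕ) → (ℕ → ℕ → ℕ) → ℕ → ℕ
conv f g zero    = 0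
conv f g (suc r) = f 0 * g 0 r + conv (λ k → f (suc k)) (λ k → g (suc k)) r

conv-cong : ∀ r {f f′ : ℕ → ℕ} {g g′ : ℕ → ℕ → ℕ} →
  (∀ k s → suc (k + s) ≡ r → f k * g k s ≡ f′ k * g′ k s) → conv f g r ≡ conv f′ g′ r
conv-cong zero    eq = refl
conv-cong (suc r) eq = cong₂ _+_ (eq 0 r refl) (conv-cong r (λ k s e → eq (suc k) s (cong suc e)))

conv-last : ∀ r (f : ℕ → ℕ) (g : ℕ → ℕ → ℕ) →
  conv f g (suc r) ≡ conv f (λ k s → g k (suc s)) r + f r * g r 0
conv-last zero    f g = +-identityʳ _
conv-last (suc r) f g rewrite conv-last r (λ k → f (suc k)) (λ k → g (suc k)) =
  sym (+-assoc (f 0 * g 0 (suc r)) _ _)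

conv-*ˡ : ∀ r c (f : ℕ → ℕ) (g : ℕ → ℕ → ℕ) → conv (λ k → c * f k) g r ≡ c * conv f g r
conv-*ˡ zero    c f g = sym (*-zeroʳ c)
conv-*ˡ (suc r) c f g rewrite conv-*ˡ r c (λ k → f (suc k)) (λ k → g (suc k)) =
  trans (cong (_+ c * conv (λ k → f (suc k)) (λ k → g (suc k)) r) (*-assoc c (f 0) (g 0 r)))
        (sym (*-distribˡ-+ c _ _))

∑-conv : ∀ n r (h : ℕ → ℕ) (f : ℕ → ℕ → ℕ) (g : ℕ → ℕ → ℕ) →
  ∑[ x < n ] (h x * conv (f x) g r) ≡ conv (λ k → ∑[ x < n ] (h x * f x k)) g r
∑-conv n zero    h f g = ∑-zero n _ (λ x _ → *-zeroʳ (h x))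
∑-conv n (suc r) h f g = begin
  ∑[ x < n ] (h x * (f x 0 * g 0 r + conv (λ k → f x (suc k)) (λ k → g (suc k)) r))
    ≡⟨ ∑-cong n (λ x _ → *-distribˡ-+ (h x) _ _) ⟩
  ∑[ x < n ] (h x * (f x 0 * g 0 r) + h x * conv (λ k → f x (suc k)) (λ k → g (suc k)) r)
    ≡⟨ ∑-+ n _ _ ⟩
  ∑[ x < n ] (h x * (f x 0 * g 0 r)) + ∑[ x < n ] (h x * conv (λ k → f x (suc k)) (λ k → g (suc k)) r)
    ≡⟨ cong₂ _+_ (trans (∑-cong n (λ x _ → sym (*-assoc (h x) _ _))) (∑-*ʳ n (g 0 r) _))
                 (∑-conv n r h (λ x k → f x (suc k)) (λ k → g (suc k))) ⟩
  ∑[ x < n ] (h x * f x 0) * g 0 r + conv (λ k → ∑[ x < n ] (h x * f x (suc k))) (λ k → g (suc k)) r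
    ∎
  where open ≡-Reasoning

module _ {A : Set} where

  sum-map-filterᵇ : ∀ (P : A → Bool) (f : A → ℕ) xs →
    sum (map f (filterᵇ P xs)) ≡ sum (map (λ x → 𝟙 (P x) * f x) xs)
  sum-map-filterᵇ P f []       = refl
  sum-map-filterᵇ P f (x ∷ xs) with P x
  ... | true  = cong₂ _+_ (sym (+-identityʳ (f x))) (sum-map-filterᵇ P f xs)
  ... | false = sum-map-filterᵇ P f xs

  length-filterᵇ : ∀ (P : A → Bool) xs → length (filterᵇ P xs) ≡ sum (map (λ x → 𝟙 (P x)) xs)
  length-filterᵇ P []       = refl
  length-filterᵇ P (x ∷ xs) with P x
  ... | true  = cong suc (length-filterᵇ P xs)
  ... | false = length-filterᵇ P xs

  sum-map-+ : ∀ (f g : A → ℕ) xs → sum (map (λ x → f x + g x) xs) ≡ sum (map f xs) + sum (map g xs)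
  sum-map-+ f g []       = refl
  sum-map-+ f g (x ∷ xs) rewrite sum-map-+ f g xs = +-interchange (f x) (g x) _ _

  sum-map-*ˡ : ∀ c (f : A → ℕ) xs → sum (map (λ x → c * f x) xs) ≡ c * sum (map f xs)
  sum-map-*ˡ c f []       = sym (*-zeroʳ c)
  sum-map-*ˡ c f (x ∷ xs) rewrite sum-map-*ˡ c f xs = sym (*-distribˡ-+ c (f x) _)

  sum-map-*ʳ : ∀ c (f : A → ℕ) xs → sum (map (λ x → f x * c) xs) ≡ sum (map f xs) * c
  sum-map-*ʳ c f []       = refl
  sum-map-*ʳ c f (x ∷ xs) rewrite sum-map-*ʳ c f xs = sym (*-distribʳ-+ c (f x) _)

  sum-map-applyUpTo : ∀ (f : ℕ → A) (g : A → ℕ) n → sum (map g (applyUpTo f n)) ≡ ∑[ x < n ] g (f x)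
  sum-map-applyUpTo f g zero    = refl
  sum-map-applyUpTo f g (suc n) = cong (g (f 0) +_) (sum-map-applyUpTo (λ x → f (suc x)) g n)

module _ {A B : Set} where

  sum-map-concatMap : ∀ (f : B → ℕ) (g : A → List B) xs →
    sum (map f (concatMap g xs)) ≡ sum (map (λ x → sum (map f (g x))) xs)
  sum-map-concatMap f g []       = refl
  sum-map-concatMap f g (x ∷ xs) = begin
    sum (map f (g x ++ concatMap g xs))
      ≡⟨ cong sum (map-++ f (g x) (concatMap g xs)) ⟩
    sum (map f (g x) ++ map f (concatMap g xs))
      ≡⟨ sum-++ (map f (g x)) _ ⟩
    sum (map f (g x)) + sum (map f (concatMap g xs))
      ≡⟨ cong (sum (map f (g x)) +_) (sum-map-concatMap f g xs) ⟩
    sum (map f (g x)) + sum (map (λ x → sum (map f (g x))) xs)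
      ∎
    where open ≡-Reasoning

  sum-map-swap : ∀ (h : A → B → ℕ) xs ys →
    sum (map (λ x → sum (map (h x) ys)) xs) ≡ sum (map (λ y → sum (map (λ x → h x y) xs)) ys)
  sum-map-swap h []       ys = sym (sum-map-zero ys)
    where
    sum-map-zero : ∀ ys → sum (map (λ (_ : B) → 0) ys) ≡ 0
    sum-map-zero []       = refl
    sum-map-zero (_ ∷ ys) = sum-map-zero ys
  sum-map-swap h (x ∷ xs) ys =
    trans (cong (sum (map (h x) ys) +_) (sum-map-swap h xs ys))
          (sym (sum-map-+ (h x) (λ y → sum (map (λ x → h x y) xs)) ys))

≤ᵇ≡not<ᵇ : ∀ m n → (n ≤ᵇ m) ≡ not (m <ᵇ n)
≤ᵇ≡not<ᵇ m       zero          = refl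
≤ᵇ≡not<ᵇ zero    (suc n)       = refl
≤ᵇ≡not<ᵇ (suc m) (suc zero)    = refl
≤ᵇ≡not<ᵇ (suc m) (suc (suc n)) = ≤ᵇ≡not<ᵇ m (suc n)

<ᵇ≡true : ∀ {m n} → m < n → (m <ᵇ n) ≡ true
<ᵇ≡true m<n = Equivalence.to T-≡ (<⇒<ᵇ m<n)

<ᵇ≡false : ∀ {m n} → n ≤ m → (m <ᵇ n) ≡ false
<ᵇ≡false {m} {n} n≤m = Equivalence.to T-not-≡ (subst T (≤ᵇ≡not<ᵇ m n) (≤⇒≤ᵇ n≤m))

<ᵇ-⊔ : ∀ x a b → (x <ᵇ a ⊔ b) ≡ (x <ᵇ a) ∨ (x <ᵇ b)
<ᵇ-⊔ x       zero    b       = refl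
<ᵇ-⊔ x       (suc a) zero    = sym (∨-identityʳ _)
<ᵇ-⊔ zero    (suc a) (suc b) = refl
<ᵇ-⊔ (suc x) (suc a) (suc b) = <ᵇ-⊔ x a b

∨-absorbʳ : ∀ b c → (T c → T b) → b ∨ c ≡ b
∨-absorbʳ true  c     _   = refl
∨-absorbʳ false false _   = refl
∨-absorbʳ false true  c⇒b = ⊥-elim (c⇒b _)

half-bound : ∀ {a n} → 2 * a ≤ n → a ≤ n / 2
half-bound {a} {n} 2a≤n = subst (_≤ n / 2) (trans (cong (_/ 2) (*-comm 2 a)) (m*n/n≡m a 2)) (/-monoˡ-≤ 2 2a≤n)

#true : List Bool → ℕ
#true as = sum (map 𝟙 as)

endFlag : Bool → List Bool → Bool
endFlag p []       = p
endFlag p (a ∷ as) = endFlag a as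

endFlag-∷ʳ : ∀ p as a → endFlag p (as ++ [ a ]) ≡ a
endFlag-∷ʳ p []       a = refl
endFlag-∷ʳ p (b ∷ as) a = endFlag-∷ʳ b as a

hasAdjacentTrues : List Bool → Bool
hasAdjacentTrues (a ∷ b ∷ bs) = (a ∧ b) ∨ hasAdjacentTrues (b ∷ bs)
hasAdjacentTrues _            = false

hasAdjacentTrues-false∷ : ∀ as → hasAdjacentTrues (false ∷ as) ≡ hasAdjacentTrues as
hasAdjacentTrues-false∷ []      = refl
hasAdjacentTrues-false∷ (_ ∷ _) = refl

-- p stands for the letter preceding the word.
wordWeight : (Bool → Bool → ℕ) → Bool → List Bool → ℕ
wordWeight w p []       = 1
wordWeight w p (a ∷ as) = w p a * wordWeight w a as

wordWeight-∷ʳ : ∀ w p as a → wordWeight w p (as ++ [ a ]) ≡ wordWeight w p as * w (endFlag p as) a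
wordWeight-∷ʳ w p []       a = trans (*-identityʳ (w p a)) (sym (*-identityˡ (w p a)))
wordWeight-∷ʳ w p (b ∷ as) a =
  trans (cong (w p b *_) (wordWeight-∷ʳ w b as a)) (sym (*-assoc (w p b) _ _))

ascentWeight : ℕ → Bool → Bool → ℕ
ascentWeight t _ a = t ^ 𝟙 a

wordWeight-ascent : ∀ t p as → wordWeight (ascentWeight t) p as ≡ t ^ #true as
wordWeight-ascent t p []       = refl
wordWeight-ascent t p (a ∷ as) =
  trans (cong (t ^ 𝟙 a *_) (wordWeight-ascent t a as)) (sym (^-distribˡ-+-* t (𝟙 a) (#true as)))

gammaWeight : ℕ → Bool → Bool → ℕ
gammaWeight t false true  = t
gammaWeight t true  true  = 0
gammaWeight t false false = suc t
gammaWeight t true  false = 1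

gammaEnd : Bool → ℕ
gammaEnd false = 1
gammaEnd true  = 0

isGammaWord : List Bool → Bool
isGammaWord as = not (hasAdjacentTrues as) ∧ not (endFlag false as)

isGammaWord-false∷ : ∀ as → isGammaWord (false ∷ as) ≡ isGammaWord as
isGammaWord-false∷ as = cong (λ b → not b ∧ not (endFlag false as)) (hasAdjacentTrues-false∷ as)

isGammaWord-bound : ∀ as → T (isGammaWord as) → 2 * #true as ≤ length as
isGammaWord-bound []                   _    = z≤n
isGammaWord-bound (false ∷ as)         good =
  m≤n⇒m≤1+n (isGammaWord-bound as (subst T (isGammaWord-false∷ as) good))
isGammaWord-bound (true ∷ false ∷ as)  good =
  subst (_≤ suc (suc (length as))) (sym (*-suc 2 (#true as)))
        (s≤s (s≤s (isGammaWord-bound as (subst T (isGammaWord-false∷ as) good))))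

wordWeight-gamma : ∀ t as →
  wordWeight (gammaWeight t) false as * gammaEnd (endFlag false as)
    ≡ 𝟙 (isGammaWord as) * (t ^ #true as * suc t ^ (length as ∸ 2 * #true as))
wordWeight-gamma t []                  = refl
wordWeight-gamma t (true ∷ [])         = *-zeroʳ (t * 1)
wordWeight-gamma t (true ∷ true ∷ as)  = cong (_* gammaEnd (endFlag true as)) (*-zeroʳ t)
wordWeight-gamma t (true ∷ false ∷ as) = begin
  t * (1 * W) * E                          ≡⟨ cong (_* E) (cong (t *_) (*-identityˡ W)) ⟩
  t * W * E                                ≡⟨ *-assoc t W E ⟩
  t * (W * E)                              ≡⟨ cong (t *_) (wordWeight-gamma t as) ⟩
  t * (𝟙 g * (t ^ c * suc t ^ (L ∸ 2 * c)))  ≡⟨ rearrange t (𝟙 g) (t ^ c) (suc t ^ (L ∸ 2 * c)) ⟩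
  𝟙 g * (t ^ suc c * suc t ^ (L ∸ 2 * c))
    ≡⟨ cong₂ (λ b z → 𝟙 b * (t ^ suc c * suc t ^ (suc (suc L) ∸ z))) (sym (isGammaWord-false∷ as)) (sym (*-suc 2 c)) ⟩
  𝟙 (isGammaWord (true ∷ false ∷ as)) * (t ^ suc c * suc t ^ (suc (suc L) ∸ 2 * suc c)) ∎
  where
  open ≡-Reasoning
  W = wordWeight (gammaWeight t) false as
  E = gammaEnd (endFlag false as)
  c = #true as
  L = length as
  g = isGammaWord as
  rearrange : ∀ t a b d → t * (a * (b * d)) ≡ a * (t * b * d)
  rearrange = solve-∀
wordWeight-gamma t (false ∷ as) = begin
  suc t * W * E                              ≡⟨ *-assoc (suc t) W E ⟩
  suc t * (W * E)                            ≡⟨ cong (suc t *_) (wordWeight-gamma t as) ⟩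
  suc t * (𝟙 g * (t ^ c * suc t ^ (L ∸ 2 * c)))  ≡⟨ rearrange (suc t) (𝟙 g) (t ^ c) (suc t ^ (L ∸ 2 * c)) ⟩
  𝟙 g * (t ^ c * suc t ^ suc (L ∸ 2 * c))      ≡⟨ 𝟙*-cong g (λ good → cong (λ z → t ^ c * suc t ^ z) (sym (+-∸-assoc 1 (isGammaWord-bound as good)))) ⟩
  𝟙 g * (t ^ c * suc t ^ (suc L ∸ 2 * c))      ≡⟨ cong (λ b → 𝟙 b * (t ^ c * suc t ^ (suc L ∸ 2 * c))) (sym (isGammaWord-false∷ as)) ⟩
  𝟙 (isGammaWord (false ∷ as)) * (t ^ c * suc t ^ (suc L ∸ 2 * c)) ∎
  where
  open ≡-Reasoning
  W = wordWeight (gammaWeight t) false as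
  E = gammaEnd (endFlag false as)
  c = #true as
  L = length as
  g = isGammaWord as
  rearrange : ∀ y a b d → y * (a * (b * d)) ≡ a * (b * (y * d))
  rearrange = solve-∀

ascents : List ℕ → List Bool
ascents (x ∷ y ∷ ys) = (x <ᵇ y) ∷ ascents (y ∷ ys)
ascents _            = []

endsWithAscent : List ℕ → Bool
endsWithAscent e = endFlag false (ascents e)

final : List ℕ → ℕ
final []           = 0
final (x ∷ [])     = x
final (x ∷ y ∷ ys) = final (y ∷ ys)

maxEntry : List ℕ → ℕ
maxEntry = foldr _⊔_ 0

final-∷ʳ : ∀ e x → final (e ++ [ x ]) ≡ x
final-∷ʳ []           x = refl
final-∷ʳ (a ∷ [])     x = refl
final-∷ʳ (a ∷ b ∷ bs) x = final-∷ʳ (b ∷ bs) x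

maxEntry-∷ʳ : ∀ e x → maxEntry (e ++ [ x ]) ≡ maxEntry e ⊔ x
maxEntry-∷ʳ []      x = ⊔-identityʳ x
maxEntry-∷ʳ (a ∷ e) x = trans (cong (a ⊔_) (maxEntry-∷ʳ e x)) (sym (⊔-assoc a (maxEntry e) x))

ascents-∷ʳ : ∀ a e x → ascents ((a ∷ e) ++ [ x ]) ≡ ascents (a ∷ e) ++ [ final (a ∷ e) <ᵇ x ]
ascents-∷ʳ a []      x = refl
ascents-∷ʳ a (b ∷ e) x = cong ((a <ᵇ b) ∷_) (ascents-∷ʳ b e x)

length-ascents : ∀ a e → length (ascents (a ∷ e)) ≡ length e
length-ascents a []      = refl
length-ascents a (b ∷ e) = cong suc (length-ascents b e)

asc-∷∷ : ∀ x y ys → asc (x ∷ y ∷ ys) ≡ 𝟙 (x <ᵇ y) + asc (y ∷ ys)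
asc-∷∷ x y ys with x <ᵇ y
... | true  = refl
... | false = refl

asc-ascents : ∀ e → asc e ≡ #true (ascents e)
asc-ascents []           = refl
asc-ascents (x ∷ [])     = refl
asc-ascents (x ∷ y ∷ ys) = trans (asc-∷∷ x y ys) (cong (𝟙 (x <ᵇ y) +_) (asc-ascents (y ∷ ys)))

hasDoubleAscent-ascents : ∀ e → hasDoubleAscent e ≡ hasAdjacentTrues (ascents e)
hasDoubleAscent-ascents []               = refl
hasDoubleAscent-ascents (x ∷ [])         = refl
hasDoubleAscent-ascents (x ∷ y ∷ [])     = refl
hasDoubleAscent-ascents (x ∷ y ∷ z ∷ zs) = cong (((x <ᵇ y) ∧ (y <ᵇ z)) ∨_) (hasDoubleAscent-ascents (y ∷ z ∷ zs))

lastWeak-ascents : ∀ e → lastWeak e ≡ not (endsWithAscent e)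
lastWeak-ascents []               = refl
lastWeak-ascents (x ∷ [])         = refl
lastWeak-ascents (x ∷ y ∷ [])     = ≤ᵇ≡not<ᵇ x y
lastWeak-ascents (x ∷ y ∷ z ∷ zs) = lastWeak-ascents (y ∷ z ∷ zs)

tildeCondition : List ℕ → Bool
tildeCondition e = not (hasDoubleAscent e) ∧ lastWeak e

isGammaWord-ascents : ∀ e → isGammaWord (ascents e) ≡ tildeCondition e
isGammaWord-ascents e = sym (cong₂ (λ a b → not a ∧ b) (hasDoubleAscent-ascents e) (lastWeak-ascents e))

any-∷ʳ : ∀ (p : ℕ → Bool) ys x → any p (ys ++ [ x ]) ≡ any p ys ∨ p x
any-∷ʳ p []       x = ∨-identityʳ (p x)
any-∷ʳ p (y ∷ ys) x = trans (cong (p y ∨_) (any-∷ʳ p ys x)) (sym (∨-assoc (p y) _ _))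

any-<ᵇ : ∀ x e → any (x <ᵇ_) e ≡ (x <ᵇ maxEntry e)
any-<ᵇ x []      = refl
any-<ᵇ x (a ∷ e) = trans (cong ((x <ᵇ a) ∨_) (any-<ᵇ x e)) (sym (<ᵇ-⊔ x a (maxEntry e)))

completes021 : List ℕ → ℕ → Bool
completes021 []      x = false
completes021 (a ∷ e) x = ((a <ᵇ x) ∧ any (x <ᵇ_) e) ∨ completes021 e x

pat21-∷ʳ : ∀ a ys x → pat21 a (ys ++ [ x ]) ≡ pat21 a ys ∨ ((a <ᵇ x) ∧ any (x <ᵇ_) ys)
pat21-∷ʳ a []       x = sym (∧-zeroʳ (a <ᵇ x))
pat21-∷ʳ a (y ∷ ys) x =
  trans (cong₂ _∨_ (any-∷ʳ (λ z → (a <ᵇ z) ∧ (z <ᵇ y)) ys x) (pat21-∷ʳ a ys x))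
        (regroup (any (λ z → (a <ᵇ z) ∧ (z <ᵇ y)) ys) (a <ᵇ x) (x <ᵇ y) (pat21 a ys) (any (x <ᵇ_) ys))
  where
  regroup : ∀ b c d b′ d′ → (b ∨ (c ∧ d)) ∨ (b′ ∨ (c ∧ d′)) ≡ (b ∨ b′) ∨ (c ∧ (d ∨ d′))
  regroup = solve 5 (λ b c d b′ d′ → (b :+ (c :* d)) :+ (b′ :+ (c :* d′)) := (b :+ b′) :+ (c :* (d :+ d′))) refl

contains021-∷ʳ : ∀ e x → contains021 (e ++ [ x ]) ≡ contains021 e ∨ completes021 e x
contains021-∷ʳ []      x = refl
contains021-∷ʳ (a ∷ e) x =
  trans (cong₂ _∨_ (pat21-∷ʳ a e x) (contains021-∷ʳ e x))
        (regroup (pat21 a e) (contains021 e) _ (completes021 e x))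
  where
  regroup : ∀ p q r s → (p ∨ r) ∨ (q ∨ s) ≡ (p ∨ q) ∨ (r ∨ s)
  regroup = solve 4 (λ p q r s → (p :+ r) :+ (q :+ s) := (p :+ q) :+ (r :+ s)) refl

completes021⇒ : ∀ e x → T (completes021 e x) → 0 < x × x < maxEntry e
completes021⇒ (a ∷ e) x h with Equivalence.to T-∨ h
... | inj₁ new with Equivalence.to T-∧ new
...   | a<x , x<e = ≤-<-trans z≤n (<ᵇ⇒< a x a<x) ,
                    <-≤-trans (<ᵇ⇒< x (maxEntry e) (subst T (any-<ᵇ x e) x<e)) (m≤n⊔m a (maxEntry e))
completes021⇒ (a ∷ e) x h | inj₂ old with completes021⇒ e x old
... | 0<x , x<e = 0<x , <-≤-trans x<e (m≤n⊔m a (maxEntry e))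

-- For 0 < x < max take e_i the leading 0 and e_j the maximum.
completes021-0∷ : ∀ e x → completes021 (0 ∷ e) x ≡ (0 <ᵇ x) ∧ (x <ᵇ maxEntry e)
completes021-0∷ e x =
  trans (cong (λ b → ((0 <ᵇ x) ∧ b) ∨ completes021 e x) (any-<ᵇ x e))
        (∨-absorbʳ _ _ (λ h → case completes021⇒ e x h of λ where
          (0<x , x<e) → Equivalence.from T-∧ (<⇒<ᵇ 0<x , <⇒<ᵇ x<e)))

admissible : ℕ → ℕ → Bool
admissible m x = not ((0 <ᵇ x) ∧ (x <ᵇ m))

avoids021-∷ʳ : ∀ e x → avoids021 ((0 ∷ e) ++ [ x ]) ≡ avoids021 (0 ∷ e) ∧ admissible (maxEntry e) x
avoids021-∷ʳ e x =
  trans (cong not (contains021-∷ʳ (0 ∷ e) x))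
        (trans (not-∨ (contains021 (0 ∷ e)) _)
               (cong (λ b → avoids021 (0 ∷ e) ∧ not b) (completes021-0∷ e x)))
  where
  not-∨ : ∀ a b → not (a ∨ b) ≡ not a ∧ not b
  not-∨ true  b = refl
  not-∨ false b = refl

I-shape : ∀ n → All (λ e → Σ (List ℕ) λ rest → e ≡ 0 ∷ rest × length rest ≡ n) (I (suc n))
I-shape zero    = ([] , refl , refl) ∷ []
I-shape (suc n) = concat⁺ (map⁺ (All.map appended (I-shape n)))
  where
  appended : ∀ {e} → Σ (List ℕ) (λ rest → e ≡ 0 ∷ rest × length rest ≡ n) →
    All (λ e′ → Σ (List ℕ) λ rest → e′ ≡ 0 ∷ rest × length rest ≡ suc n) (map (λ x → e ++ [ x ]) (upTo (suc (suc n))))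
  appended (rest , refl , refl) =
    map⁺ (All.universal (λ x → rest ++ [ x ] , refl , trans (length-++ rest) (+-comm (length rest) 1)) _)

sum-I-cong : ∀ n {f g : List ℕ → ℕ} → (∀ rest → length rest ≡ n → f (0 ∷ rest) ≡ g (0 ∷ rest)) →
  sum (map f (I (suc n))) ≡ sum (map g (I (suc n)))
sum-I-cong n eq = cong sum (map-cong-local (All.map (λ { (rest , refl , len) → eq rest len }) (I-shape n)))

sum-I₁ : ∀ (f : List ℕ → ℕ) → sum (map f (I 1)) ≡ f (0 ∷ [])
sum-I₁ f = +-identityʳ (f (0 ∷ []))

-- extensions r n m l p: total weight of the ways to append r admissible entries to a sequence of
-- length n with maximum m and last entry l whose last step is an ascent iff p.  A step that is an
-- ascent iff a, following one that is an ascent iff p, weighs w p a; the end weighs τ of the last flag.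
module Extensions (w : Bool → Bool → ℕ) (τ : Bool → ℕ) where

  mutual
    extensions : ℕ → ℕ → ℕ → ℕ → Bool → ℕ
    extensions zero    n m l p = τ p
    extensions (suc r) n m l p = ∑[ x < suc n ] extend r n m l p x

    extend : ℕ → ℕ → ℕ → ℕ → Bool → ℕ → ℕ
    extend r n m l p x = 𝟙 (admissible m x) * (w p (l <ᵇ x) * extensions r (suc n) (m ⊔ x) x (l <ᵇ x))

  weight : List ℕ → ℕ
  weight e = wordWeight w false (ascents e)

  completions : ℕ → ℕ → List ℕ → ℕ
  completions r n e = 𝟙 (avoids021 e) * (weight e * extensions r n (maxEntry e) (final e) (endsWithAscent e))

  completions-∷ʳ : ∀ r n rest x →
    completions r (suc n) ((0 ∷ rest) ++ [ x ])
      ≡ 𝟙 (avoids021 (0 ∷ rest)) * (weight (0 ∷ rest) * extend r n (maxEntry rest) (final (0 ∷ rest)) (endsWithAscent (0 ∷ rest)) x)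
  completions-∷ʳ r n rest x = begin
    𝟙 (avoids021 (e ++ [ x ])) * (weight (e ++ [ x ]) * extensions r (suc n) (maxEntry (e ++ [ x ])) (final (e ++ [ x ])) (endsWithAscent (e ++ [ x ])))
      ≡⟨ cong₂ (λ b W → 𝟙 b * (W * extensions r (suc n) (maxEntry (e ++ [ x ])) (final (e ++ [ x ])) (endsWithAscent (e ++ [ x ]))))
               (avoids021-∷ʳ rest x) (trans (cong (wordWeight w false) (ascents-∷ʳ 0 rest x)) (wordWeight-∷ʳ w false (ascents e) a)) ⟩
    𝟙 (avoids021 e ∧ admissible M x) * (weight e * w p a * extensions r (suc n) (maxEntry (e ++ [ x ])) (final (e ++ [ x ])) (endsWithAscent (e ++ [ x ])))
      ≡⟨ cong₂ (λ b F → b * (weight e * w p a * F)) (𝟙-∧ (avoids021 e) (admissible M x))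
               (trans (cong₂ (λ m′ l′ → extensions r (suc n) m′ l′ (endsWithAscent (e ++ [ x ]))) (maxEntry-∷ʳ e x) (final-∷ʳ e x))
                      (cong (extensions r (suc n) (M ⊔ x) x) flag-∷ʳ)) ⟩
    𝟙 (avoids021 e) * 𝟙 (admissible M x) * (weight e * w p a * extensions r (suc n) (M ⊔ x) x a)
      ≡⟨ rearrange (𝟙 (avoids021 e)) (𝟙 (admissible M x)) (weight e) (w p a) _ ⟩
    𝟙 (avoids021 e) * (weight e * extend r n M (final e) p x)
      ∎
    where
    open ≡-Reasoning
    e = 0 ∷ rest
    M = maxEntry rest
    p = endsWithAscent e
    a = final e <ᵇ x
    flag-∷ʳ : endsWithAscent (e ++ [ x ]) ≡ a
    flag-∷ʳ = trans (cong (endFlag false) (ascents-∷ʳ 0 rest x)) (endFlag-∷ʳ false (ascents e) a)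
    rearrange : ∀ i j W v F → i * j * (W * v * F) ≡ i * (W * (j * (v * F)))
    rearrange = solve-∀

  sum-completions : ∀ r n → sum (map (completions 0 (suc n + r)) (I (suc n + r))) ≡ sum (map (completions r (suc n)) (I (suc n)))
  sum-completions zero    n = cong (λ k → sum (map (completions 0 (suc k)) (I (suc k)))) (+-identityʳ n)
  sum-completions (suc r) n = begin
    sum (map (completions 0 (suc n + suc r)) (I (suc n + suc r)))
      ≡⟨ cong (λ k → sum (map (completions 0 (suc k)) (I (suc k)))) (+-suc n r) ⟩
    sum (map (completions 0 (suc (suc n) + r)) (I (suc (suc n) + r)))
      ≡⟨ sum-completions r (suc n) ⟩
    sum (map (completions r (suc (suc n))) (I (suc (suc n))))
      ≡⟨ sum-map-concatMap (completions r (suc (suc n))) _ (I (suc n)) ⟩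
    sum (map (λ e → sum (map (completions r (suc (suc n))) (map (λ x → e ++ [ x ]) (upTo (suc (suc n)))))) (I (suc n)))
      ≡⟨ sum-I-cong n (λ rest _ → appended rest) ⟩
    sum (map (completions (suc r) (suc n)) (I (suc n)))
      ∎
    where
    open ≡-Reasoning
    appended : ∀ rest → sum (map (completions r (suc (suc n))) (map (λ x → (0 ∷ rest) ++ [ x ]) (upTo (suc (suc n)))))
                          ≡ completions (suc r) (suc n) (0 ∷ rest)
    appended rest = begin
      sum (map (completions r (suc (suc n))) (map (λ x → (0 ∷ rest) ++ [ x ]) (upTo (suc (suc n)))))
        ≡⟨ cong sum (sym (map-∘ {g = completions r (suc (suc n))} {f = λ x → (0 ∷ rest) ++ [ x ]} (upTo (suc (suc n))))) ⟩
      sum (map (λ x → completions r (suc (suc n)) ((0 ∷ rest) ++ [ x ])) (upTo (suc (suc n))))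
        ≡⟨ sum-map-applyUpTo (λ x → x) (λ x → completions r (suc (suc n)) ((0 ∷ rest) ++ [ x ])) (suc (suc n)) ⟩
      ∑[ x < suc (suc n) ] completions r (suc (suc n)) ((0 ∷ rest) ++ [ x ])
        ≡⟨ ∑-cong (suc (suc n)) (λ x _ → completions-∷ʳ r (suc n) rest x) ⟩
      ∑[ x < suc (suc n) ] (A * (W * extend r (suc n) (maxEntry rest) (final (0 ∷ rest)) (endsWithAscent (0 ∷ rest)) x))
        ≡⟨ ∑-*ˡ (suc (suc n)) A (λ x → W * extend r (suc n) (maxEntry rest) (final (0 ∷ rest)) (endsWithAscent (0 ∷ rest)) x) ⟩
      A * ∑[ x < suc (suc n) ] (W * extend r (suc n) (maxEntry rest) (final (0 ∷ rest)) (endsWithAscent (0 ∷ rest)) x)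
        ≡⟨ cong (A *_) (∑-*ˡ (suc (suc n)) W (extend r (suc n) (maxEntry rest) (final (0 ∷ rest)) (endsWithAscent (0 ∷ rest)))) ⟩
      completions (suc r) (suc n) (0 ∷ rest)
        ∎
      where
      A = 𝟙 (avoids021 (0 ∷ rest))
      W = weight (0 ∷ rest)

  extensions-max0 : ∀ r n l p → extensions r n 0 l p ≡ extensions r n 1 l p
  extensions-max0 zero    n l p = refl
  extensions-max0 (suc r) n l p = ∑-cong (suc n) {extend r n 0 l p} {extend r n 1 l p} λ where
    zero    _ → cong (λ e → 1 * (w p false * e)) (extensions-max0 r (suc n) 0 false)
    (suc x) _ → refl

  sum-I-weights : ∀ n → sum (map (completions 0 (suc n)) (I (suc n))) ≡ extensions n 1 1 0 false
  sum-I-weights n = begin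
    sum (map (completions 0 (suc n)) (I (suc n)))
      ≡⟨ sum-completions n 0 ⟩
    sum (map (completions n 1) (I 1))
      ≡⟨ trans (sum-I₁ (completions n 1)) (trans (*-identityˡ _) (*-identityˡ _)) ⟩
    extensions n 1 0 0 false
      ≡⟨ extensions-max0 n 1 0 false ⟩
    extensions n 1 1 0 false
      ∎
    where open ≡-Reasoning

  saturated : ∀ r n l p → extensions (suc r) n (suc n) l p ≡ w p false * extensions r (suc n) (suc n) 0 false
  saturated r n l p =
    trans (cong₂ _+_ (*-identityˡ _) (∑-zero n (λ x → extend r n (suc n) l p (suc x)) inadmissible)) (+-identityʳ _)
    where
    inadmissible : ∀ x → x < n → extend r n (suc n) l p (suc x) ≡ 0
    inadmissible x x<n rewrite <ᵇ≡true x<n = refl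

  module Widening (t : ℕ) (hit : ∀ p → w p true ≡ t * τ p) where

    -- Valleys and peaks have maximum n + 1 at length n + 1, so only 0 and n + 1 may follow.
    valley : ℕ → ℕ → ℕ
    valley n r = extensions r (suc n) (suc n) 0 false

    peak : ℕ → ℕ → Bool → ℕ
    peak n r p = extensions r (suc n) (suc n) (suc n) p

    top-extend : ∀ r n m l p → m ≤ suc n → extend r n m l p (suc n) ≡ w p (l <ᵇ suc n) * peak n r (l <ᵇ suc n)
    top-extend r n m l p m≤ rewrite <ᵇ≡false {suc n} m≤ | m≤n⇒m⊔n≡n m≤ = *-identityˡ _

    -- Length n + 1 allows one more top value than length n at every later step.  A continuation
    -- that uses it is cut at its last use: from there on it is a continuation of a peak.
    mutual
      widen : ∀ r n m l p → m ≤ suc n → l < suc n →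
        extensions r (suc n) m l p
          ≡ extensions r n m l p + t * conv (λ k → extensions k (suc n) m l p) (λ k s → peak (k + n) s true) r
      widen zero    n m l p _  _  = sym (trans (cong (τ p +_) (*-zeroʳ t)) (+-identityʳ (τ p)))
      widen (suc r) n m l p m≤ l< = begin
        extensions (suc r) (suc n) m l p
          ≡⟨ widen-step r n m l p m≤ ⟩
        extensions (suc r) n m l p + w p (l <ᵇ suc n) * peak n r (l <ᵇ suc n) + t * conv G (λ k s → peak (k + suc n) s true) r
          ≡⟨ cong (λ a → extensions (suc r) n m l p + w p a * peak n r a + t * conv G (λ k s → peak (k + suc n) s true) r) (<ᵇ≡true l<) ⟩
        extensions (suc r) n m l p + w p true * peak n r true + t * conv G (λ k s → peak (k + suc n) s true) r
          ≡⟨ cong₂ (λ v c → extensions (suc r) n m l p + v * peak n r true + t * c) (hit p)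
                   (conv-cong r (λ k s _ → cong (λ i → G k * peak i s true) (+-suc k n))) ⟩
        extensions (suc r) n m l p + t * τ p * peak n r true + t * conv G (λ k s → peak (suc k + n) s true) r
          ≡⟨ +-assoc (extensions (suc r) n m l p) _ _ ⟩
        extensions (suc r) n m l p + (t * τ p * peak n r true + t * conv G (λ k s → peak (suc k + n) s true) r)
          ≡⟨ cong (extensions (suc r) n m l p +_)
                  (trans (cong (_+ t * conv G (λ k s → peak (suc k + n) s true) r) (*-assoc t (τ p) _))
                         (sym (*-distribˡ-+ t _ _))) ⟩
        extensions (suc r) n m l p + t * conv (λ k → extensions k (suc n) m l p) (λ k s → peak (k + n) s true) (suc r)
          ∎
        where
        open ≡-Reasoning
        G : ℕ → ℕ
        G k = extensions (suc k) (suc n) m l p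

      widen-step : ∀ r n m l p → m ≤ suc n →
        extensions (suc r) (suc n) m l p
          ≡ extensions (suc r) n m l p + w p (l <ᵇ suc n) * peak n r (l <ᵇ suc n)
            + t * conv (λ k → extensions (suc k) (suc n) m l p) (λ k s → peak (k + suc n) s true) r
      widen-step r n m l p m≤ = begin
        ∑[ x < suc (suc n) ] extend r (suc n) m l p x
          ≡⟨ ∑-cong (suc (suc n)) (λ x x< → extend-widened x x<) ⟩
        ∑[ x < suc (suc n) ] (extend r n m l p x + t * (h x * conv (F x) P r))
          ≡⟨ ∑-+ (suc (suc n)) (extend r n m l p) (λ x → t * (h x * conv (F x) P r)) ⟩
        ∑[ x < suc (suc n) ] extend r n m l p x + ∑[ x < suc (suc n) ] (t * (h x * conv (F x) P r))
          ≡⟨ cong₂ _+_ (∑-last (suc n) (extend r n m l p)) (∑-*ˡ (suc (suc n)) t (λ x → h x * conv (F x) P r)) ⟩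
        extensions (suc r) n m l p + extend r n m l p (suc n) + t * ∑[ x < suc (suc n) ] (h x * conv (F x) P r)
          ≡⟨ cong₂ (λ a b → extensions (suc r) n m l p + a + t * b) (top-extend r n m l p m≤) (∑-conv (suc (suc n)) r h F P) ⟩
        extensions (suc r) n m l p + w p (l <ᵇ suc n) * peak n r (l <ᵇ suc n)
          + t * conv (λ k → ∑[ x < suc (suc n) ] (h x * F x k)) P r
          ≡⟨ cong (λ c → extensions (suc r) n m l p + w p (l <ᵇ suc n) * peak n r (l <ᵇ suc n) + t * c)
                  (conv-cong r (λ k s _ → cong (_* P k s) (∑-cong (suc (suc n)) (λ x _ → *-assoc (𝟙 (admissible m x)) (w p (l <ᵇ x)) (F x k))))) ⟩
        extensions (suc r) n m l p + w p (l <ᵇ suc n) * peak n r (l <ᵇ suc n)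
          + t * conv (λ k → extensions (suc k) (suc n) m l p) P r
          ∎
        where
        open ≡-Reasoning
        h : ℕ → ℕ
        h x = 𝟙 (admissible m x) * w p (l <ᵇ x)
        F : ℕ → ℕ → ℕ
        F x k = extensions k (suc (suc n)) (m ⊔ x) x (l <ᵇ x)
        P : ℕ → ℕ → ℕ
        P k s = peak (k + suc n) s true
        extend-widened : ∀ x → x < suc (suc n) → extend r (suc n) m l p x ≡ extend r n m l p x + t * (h x * conv (F x) P r)
        extend-widened x x<
          rewrite widen r (suc n) (m ⊔ x) x (l <ᵇ x) (⊔-lub (m≤n⇒m≤1+n m≤) (m≤n⇒m≤1+n (≤-pred x<))) x< =
          distrib (𝟙 (admissible m x)) (w p (l <ᵇ x)) (extensions r (suc n) (m ⊔ x) x (l <ᵇ x)) t (conv (F x) P r)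
          where
          distrib : ∀ a b c t d → a * (b * (c + t * d)) ≡ a * (b * c) + t * (a * b * d)
          distrib = solve-∀

    valley-rec : ∀ n r →
      valley n (suc r) ≡ w false false * valley n r + t * conv (valley n) (λ k s → peak (k + n) s true) (suc r)
    valley-rec n r = trans (widen (suc r) n (suc n) 0 false ≤-refl (s≤s z≤n))
                           (cong (_+ t * conv (valley n) (λ k s → peak (k + n) s true) (suc r)) (saturated r n 0 false))

    peak-rec : ∀ n r p →
      peak n (suc r) p
        ≡ w p false * valley n r + w p false * peak n r false
          + t * conv (λ k → peak n (suc k) p) (λ k s → peak (k + suc n) s true) r
    peak-rec n r p =
      trans (widen-step r n (suc n) (suc n) p ≤-refl)
            (cong₂ (λ a b → a + b + t * conv (λ k → peak n (suc k) p) (λ k s → peak (k + suc n) s true) r)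
                   (saturated r n (suc n) p) (cong (λ a → w p a * peak n r a) (<ᵇ≡false {n} ≤-refl)))

gamma-hit : ∀ t p → gammaWeight t p true ≡ t * gammaEnd p
gamma-hit t false = sym (*-identityʳ t)
gamma-hit t true  = sym (*-zeroʳ t)

module GammaExpansion (t : ℕ) where
  module A = Extensions (ascentWeight t) (λ _ → 1)
  module C = Extensions (gammaWeight t) gammaEnd
  open A.Widening t (λ _ → refl) public using ()
    renaming (valley to valleyA; peak to peakA; valley-rec to valleyA-rec; peak-rec to peakA-rec)
  open C.Widening t (gamma-hit t) public using ()
    renaming (valley to valleyC; peak to peakC; valley-rec to valleyC-rec; peak-rec to peakC-rec)

  -- The first step from a peak is never an ascent, so the flag changes its weight from 1 + t to 1.
  PeakDescent : ℕ → Set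
  PeakDescent r = ∀ n → peakC n (suc r) false ≡ suc t * peakC n (suc r) true

  peakC-descent : ∀ r → PeakDescent r
  peakC-descent = <-rec PeakDescent step
    where
    step : ∀ r → (∀ {k} → k < r → PeakDescent k) → PeakDescent r
    step r ih n = begin
      peakC n (suc r) false
        ≡⟨ peakC-rec n r false ⟩
      suc t * valleyC n r + suc t * peakC n r false + t * conv (λ k → peakC n (suc k) false) Q r
        ≡⟨ cong (λ c → suc t * valleyC n r + suc t * peakC n r false + t * c) conv-descent ⟩
      suc t * valleyC n r + suc t * peakC n r false + t * (suc t * conv (λ k → peakC n (suc k) true) Q r)
        ≡⟨ factor (suc t) t (valleyC n r) (peakC n r false) (conv (λ k → peakC n (suc k) true) Q r) ⟩
      suc t * (1 * valleyC n r + 1 * peakC n r false + t * conv (λ k → peakC n (suc k) true) Q r)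
        ≡⟨ cong (suc t *_) (sym (peakC-rec n r true)) ⟩
      suc t * peakC n (suc r) true
        ∎
      where
      open ≡-Reasoning
      Q : ℕ → ℕ → ℕ
      Q k s = peakC (k + suc n) s true
      conv-descent : conv (λ k → peakC n (suc k) false) Q r ≡ suc t * conv (λ k → peakC n (suc k) true) Q r
      conv-descent =
        trans (conv-cong r (λ k s k+s<r → cong (_* Q k s) (ih (≤-trans (s≤s (m≤m+n k s)) (≤-reflexive k+s<r)) n)))
              (conv-*ˡ r (suc t) (λ k → peakC n (suc k) true) Q)
      factor : ∀ y t a b c → y * a + y * b + t * (y * c) ≡ y * (1 * a + 1 * b + t * c)
      factor = solve-∀

  -- At r = 0 the peaks differ (1 against 0); in the valley recursion this is made up by the
  -- weight 1 + t that the second system gives to a plain descent.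
  Agree : ℕ → Set
  Agree r = ∀ n → valleyA n r ≡ valleyC n r × peakA n (suc r) true ≡ peakC n (suc r) true

  agree : ∀ r → Agree r
  agree = <-rec Agree λ r ih n → let v = valley-agree r ih n in v , peak-agree r ih n v
    where
    split-left : ∀ k s {r} → suc (k + s) ≡ r → k < suc r
    split-left k s k+s<r = s≤s (≤-trans (m≤m+n k s) (≤-trans (n≤1+n _) (≤-reflexive k+s<r)))
    split-right : ∀ k s {r} → suc (k + s) ≡ r → s < suc r
    split-right k s k+s<r = s≤s (≤-trans (m≤n+m s k) (≤-trans (n≤1+n _) (≤-reflexive k+s<r)))

    valley-agree : ∀ r → (∀ {k} → k < r → Agree k) → ∀ n → valleyA n r ≡ valleyC n r
    valley-agree zero    ih n = refl
    valley-agree (suc r) ih n = begin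
      valleyA n (suc r)
        ≡⟨ valleyA-rec n r ⟩
      1 * valleyA n r + t * conv (valleyA n) (λ k s → peakA (k + n) s true) (suc r)
        ≡⟨ cong (λ c → 1 * valleyA n r + t * c) (conv-last r (valleyA n) (λ k s → peakA (k + n) s true)) ⟩
      1 * valleyA n r + t * (conv (valleyA n) (λ k s → peakA (k + n) (suc s) true) r + valleyA n r * 1)
        ≡⟨ cong₂ (λ a c → 1 * a + t * (c + a * 1)) (proj₁ (ih ≤-refl n)) conv-agree ⟩
      1 * valleyC n r + t * (conv (valleyC n) (λ k s → peakC (k + n) (suc s) true) r + valleyC n r * 1)
        ≡⟨ shift t (valleyC n r) (conv (valleyC n) (λ k s → peakC (k + n) (suc s) true) r) ⟩
      suc t * valleyC n r + t * (conv (valleyC n) (λ k s → peakC (k + n) (suc s) true) r + valleyC n r * 0)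
        ≡⟨ cong (λ c → suc t * valleyC n r + t * c) (sym (conv-last r (valleyC n) (λ k s → peakC (k + n) s true))) ⟩
      suc t * valleyC n r + t * conv (valleyC n) (λ k s → peakC (k + n) s true) (suc r)
        ≡⟨ sym (valleyC-rec n r) ⟩
      valleyC n (suc r)
        ∎
      where
      open ≡-Reasoning
      conv-agree : conv (valleyA n) (λ k s → peakA (k + n) (suc s) true) r ≡ conv (valleyC n) (λ k s → peakC (k + n) (suc s) true) r
      conv-agree = conv-cong r (λ k s e → cong₂ _*_ (proj₁ (ih (split-left k s e) n)) (proj₂ (ih (split-right k s e) (k + n))))
      shift : ∀ t a c → 1 * a + t * (c + a * 1) ≡ suc t * a + t * (c + a * 0)
      shift = solve-∀

    peak-agree : ∀ r → (∀ {k} → k < r → Agree k) → ∀ n → valleyA n r ≡ valleyC n r → peakA n (suc r) true ≡ peakC n (suc r) true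
    peak-agree zero    ih n _  = trans (peakA-rec n 0 true) (sym (peakC-rec n 0 true))
    peak-agree (suc r) ih n vr = begin
      peakA n (suc (suc r)) true
        ≡⟨ peakA-rec n (suc r) true ⟩
      1 * valleyA n (suc r) + 1 * peakA n (suc r) true + t * conv (λ k → peakA n (suc k) true) QA (suc r)
        ≡⟨ cong (λ c → 1 * valleyA n (suc r) + 1 * peakA n (suc r) true + t * c) (conv-last r (λ k → peakA n (suc k) true) QA) ⟩
      1 * valleyA n (suc r) + 1 * peakA n (suc r) true
        + t * (conv (λ k → peakA n (suc k) true) (λ k s → QA k (suc s)) r + peakA n (suc r) true * 1)
        ≡⟨ trans (cong₂ (λ a b → 1 * a + 1 * b + t * (conv (λ k → peakA n (suc k) true) (λ k s → QA k (suc s)) r + b * 1))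
                        vr (proj₂ (ih ≤-refl n)))
                 (cong (λ c → 1 * valleyC n (suc r) + 1 * peakC n (suc r) true + t * (c + peakC n (suc r) true * 1)) conv-agree) ⟩
      1 * valleyC n (suc r) + 1 * peakC n (suc r) true
        + t * (conv (λ k → peakC n (suc k) true) (λ k s → QC k (suc s)) r + peakC n (suc r) true * 1)
        ≡⟨ shift t (valleyC n (suc r)) (peakC n (suc r) true) (conv (λ k → peakC n (suc k) true) (λ k s → QC k (suc s)) r) ⟩
      1 * valleyC n (suc r) + 1 * (suc t * peakC n (suc r) true)
        + t * (conv (λ k → peakC n (suc k) true) (λ k s → QC k (suc s)) r + peakC n (suc r) true * 0)
        ≡⟨ cong₂ (λ b c → 1 * valleyC n (suc r) + 1 * b + t * c)
                 (sym (peakC-descent r n)) (sym (conv-last r (λ k → peakC n (suc k) true) QC)) ⟩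
      1 * valleyC n (suc r) + 1 * peakC n (suc r) false + t * conv (λ k → peakC n (suc k) true) QC (suc r)
        ≡⟨ sym (peakC-rec n (suc r) true) ⟩
      peakC n (suc (suc r)) true
        ∎
      where
      open ≡-Reasoning
      QA QC : ℕ → ℕ → ℕ
      QA k s = peakA (k + suc n) s true
      QC k s = peakC (k + suc n) s true
      conv-agree : conv (λ k → peakA n (suc k) true) (λ k s → QA k (suc s)) r ≡ conv (λ k → peakC n (suc k) true) (λ k s → QC k (suc s)) r
      conv-agree = conv-cong r (λ k s e → cong₂ _*_ (proj₂ (ih (split-left k s e) n)) (proj₂ (ih (split-right k s e) (k + suc n))))
      shift : ∀ t a b c → 1 * a + 1 * b + t * (c + b * 1) ≡ 1 * a + 1 * (suc t * b) + t * (c + b * 0)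
      shift = solve-∀

  lhs-valley : ∀ n → lhs (suc n) t ≡ valleyA 0 n
  lhs-valley n = begin
    sum (map (λ e → t ^ asc e) (filterᵇ avoids021 (I (suc n))))
      ≡⟨ sum-map-filterᵇ avoids021 (λ e → t ^ asc e) (I (suc n)) ⟩
    sum (map (λ e → 𝟙 (avoids021 e) * t ^ asc e) (I (suc n)))
      ≡⟨ cong sum (map-cong (λ e → cong (𝟙 (avoids021 e) *_) (ascent-weight e)) (I (suc n))) ⟩
    sum (map (A.completions 0 (suc n)) (I (suc n)))
      ≡⟨ A.sum-I-weights n ⟩
    valleyA 0 n
      ∎
    where
    open ≡-Reasoning
    ascent-weight : ∀ e → t ^ asc e ≡ A.weight e * 1
    ascent-weight e = sym (trans (*-identityʳ _) (trans (wordWeight-ascent t false (ascents e)) (cong (t ^_) (sym (asc-ascents e)))))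

  tilde-weight : ∀ n e → length (ascents e) ≡ n →
    sum (map (λ k → 𝟙 (avoids021 e) * 𝟙 ((asc e ≡ᵇ k) ∧ tildeCondition e) * (t ^ k * suc t ^ (n ∸ 2 * k))) (upTo (suc (n / 2))))
      ≡ C.completions 0 (suc n) e
  tilde-weight n e len = begin
    sum (map (λ k → 𝟙 (avoids021 e) * 𝟙 ((asc e ≡ᵇ k) ∧ G) * γ k) Ks)
      ≡⟨ cong sum (map-cong split Ks) ⟩
    sum (map (λ k → 𝟙 (avoids021 e) * (𝟙 G * (𝟙 (asc e ≡ᵇ k) * γ k))) Ks)
      ≡⟨ trans (sum-map-*ˡ (𝟙 (avoids021 e)) _ Ks) (cong (𝟙 (avoids021 e) *_) (sum-map-*ˡ (𝟙 G) _ Ks)) ⟩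
    𝟙 (avoids021 e) * (𝟙 G * sum (map (λ k → 𝟙 (asc e ≡ᵇ k) * γ k) Ks))
      ≡⟨ cong (𝟙 (avoids021 e) *_) (𝟙*-cong G (λ good →
           trans (sum-map-applyUpTo (λ k → k) (λ k → 𝟙 (asc e ≡ᵇ k) * γ k) (suc (n / 2)))
                 (∑-pick (n / 2) (asc e) γ (half-bound (bound good))))) ⟩
    𝟙 (avoids021 e) * (𝟙 G * γ (asc e))
      ≡⟨ cong (𝟙 (avoids021 e) *_) (sym gamma-weight) ⟩
    C.completions 0 (suc n) e
      ∎
    where
    open ≡-Reasoning
    G = tildeCondition e
    Ks = upTo (suc (n / 2))
    γ : ℕ → ℕ
    γ k = t ^ k * suc t ^ (n ∸ 2 * k)
    split : ∀ k → 𝟙 (avoids021 e) * 𝟙 ((asc e ≡ᵇ k) ∧ G) * γ k ≡ 𝟙 (avoids021 e) * (𝟙 G * (𝟙 (asc e ≡ᵇ k) * γ k))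
    split k = trans (cong (λ z → 𝟙 (avoids021 e) * z * γ k) (𝟙-∧ (asc e ≡ᵇ k) G))
                    (regroup (𝟙 (avoids021 e)) (𝟙 (asc e ≡ᵇ k)) (𝟙 G) (γ k))
      where
      regroup : ∀ a b c d → a * (b * c) * d ≡ a * (c * (b * d))
      regroup = solve-∀
    bound : T G → 2 * asc e ≤ n
    bound good = subst₂ (λ c L → 2 * c ≤ L) (sym (asc-ascents e)) len
                        (isGammaWord-bound (ascents e) (subst T (sym (isGammaWord-ascents e)) good))
    gamma-weight : C.weight e * gammaEnd (endsWithAscent e) ≡ 𝟙 G * γ (asc e)
    gamma-weight = trans (wordWeight-gamma t (ascents e))
      (cong₂ (λ b z → 𝟙 b * z) (isGammaWord-ascents e)
             (cong₂ (λ c L → t ^ c * suc t ^ (L ∸ 2 * c)) (sym (asc-ascents e)) len))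

  rhs-valley : ∀ n → rhs (suc n) t ≡ valleyC 0 n
  rhs-valley n = begin
    sum (map (λ k → length (Itilde (suc n) k) * t ^ k * suc t ^ (n ∸ 2 * k)) Ks)
      ≡⟨ cong sum (map-cong count-tilde Ks) ⟩
    sum (map (λ k → sum (map (h k) (I (suc n)))) Ks)
      ≡⟨ sum-map-swap h Ks (I (suc n)) ⟩
    sum (map (λ e → sum (map (λ k → h k e) Ks)) (I (suc n)))
      ≡⟨ sum-I-cong n (λ rest len → tilde-weight n (0 ∷ rest) (trans (length-ascents 0 rest) len)) ⟩
    sum (map (C.completions 0 (suc n)) (I (suc n)))
      ≡⟨ C.sum-I-weights n ⟩
    valleyC 0 n
      ∎
    where
    open ≡-Reasoning
    Ks = upTo (suc (n / 2))
    Q : ℕ → List ℕ → Bool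
    Q k e = (asc e ≡ᵇ k) ∧ tildeCondition e
    h : ℕ → List ℕ → ℕ
    h k e = 𝟙 (avoids021 e) * 𝟙 (Q k e) * (t ^ k * suc t ^ (n ∸ 2 * k))
    count-tilde : ∀ k → length (Itilde (suc n) k) * t ^ k * suc t ^ (n ∸ 2 * k) ≡ sum (map (h k) (I (suc n)))
    count-tilde k = begin
      length (Itilde (suc n) k) * t ^ k * suc t ^ (n ∸ 2 * k)
        ≡⟨ *-assoc (length (Itilde (suc n) k)) _ _ ⟩
      length (filterᵇ (Q k) (filterᵇ avoids021 (I (suc n)))) * (t ^ k * suc t ^ (n ∸ 2 * k))
        ≡⟨ cong (_* (t ^ k * suc t ^ (n ∸ 2 * k)))
                (trans (length-filterᵇ (Q k) (filterᵇ avoids021 (I (suc n))))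
                       (sum-map-filterᵇ avoids021 (λ e → 𝟙 (Q k e)) (I (suc n)))) ⟩
      sum (map (λ e → 𝟙 (avoids021 e) * 𝟙 (Q k e)) (I (suc n))) * (t ^ k * suc t ^ (n ∸ 2 * k))
        ≡⟨ sym (sum-map-*ʳ _ (λ e → 𝟙 (avoids021 e) * 𝟙 (Q k e)) (I (suc n))) ⟩
      sum (map (h k) (I (suc n)))
        ∎

theorem4p6 : (n : ℕ) → 1 ≤ n → (t : ℕ) → lhs n t ≡ rhs n t
theorem4p6 (suc n) _ t = begin
  lhs (suc n) t   ≡⟨ lhs-valley n ⟩
  valleyA 0 n     ≡⟨ proj₁ (agree n 0) ⟩
  valleyC 0 n     ≡⟨ sym (rhs-valley n) ⟩
  rhs (suc n) t   ∎
  where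
  open ≡-Reasoning
  open GammaExpansion t
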